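{- There is at most one family of polynomials $(P_F)_F$ in $\mathbb{Z}[x_1,x_2,\ldots]$, indexed by all indexed forests $F$, satisfying $P_\emptyset=1$, $\mathrm{ct}(P_F)=0$ for $F\neq\emptyset$, and for every indexed forest $F$ and every $i\ge1$, $$\tilde{\pi}_i P_F=\begin{cases}P_{F/i} & i\in\mathrm{QDes}(F),\\ -R_iP_F & i\notin\mathrm{QDes}(F).\end{cases}$$
   Context: $\mathrm{ct}$ denotes the constant term. For $i\ge1$ define operators on $\mathbb{Z}[x_1,x_2,\ldots]$ by $R_i f=f(x_1,\ldots,x_{i-1},0,x_i,x_{i+1},\ldots)$, $T_i f=\frac{1}{x_i}(R_{i+1}f-R_i f)$, and $\tilde{\pi}_i f=T_i\big((1+x_{i+1})f\big)$. An indexed forest is a sequence $F=(T_1,T_2,\ldots)$ of full binary trees (each internal node has an ordered left and right child), all but finitely many trivial (a single node). The leaves of $F$, read left to right across the sequence, are labeled $1,2,3,\ldots$. The forest with all trees trivial is $\emptyset$. $\mathrm{QDes}(F)$ is the set of $i$ such that leaves $i$ and $i+1$ are the left and right children of a common internal node. For $i\in\mathrm{QDes}(F)$, $F/i$ is obtained by deleting these two leaves (the node becomes a leaf) and relabeling leaves consecutively. -}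

module Defs where

open import Data.Nat using (ℕ; _≤_; zero; suc; _+_; _∸_; _≡ᵇ_)
open import Data.Nat.Properties using () renaming (_≟_ to _≟ℕ_)
open import Data.Bool using (Bool; true; false; T; _∨_; if_then_else_)
open import Data.List using (List; []; _∷_; _++_; map; mapMaybe; foldr)
open import Data.List.Properties using (≡-dec)
open import Data.Maybe using (Maybe; just; nothing) renaming (map to mapᴹ)
open import Data.Product using (_×_; _,_)
open import Data.Integer using (ℤ; 0ℤ; 1ℤ; -_) renaming (_+_ to _+ℤ_)
open import Data.Unit using (⊤; tt)
open import Relation.Nullary using (¬_)
open import Relation.Nullary.Decidable using (⌊_⌋)
open import Relation.Binary.PropositionalEquality using (_≡_)

-- A monomial is its exponent list: position 0 is the exponent of x₁,
-- position 1 that of x₂, etc.  Missing trailing entries are 0, so lists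
-- differing only by trailing zeros denote the same monomial.
Mono : Set
Mono = List ℕ

consZ : ℕ → List ℕ → List ℕ
consZ zero []      = []
consZ zero (b ∷ l) = zero ∷ b ∷ l
consZ (suc a) l    = suc a ∷ l

stripZeros : Mono → Mono
stripZeros = foldr consZ []

-- A polynomial is a finite formal sum  Σ c · x^e  of terms (c , e).
Poly : Set
Poly = List (ℤ × Mono)

coeff : Poly → Mono → ℤ
coeff p m = foldr (λ { (c , e) acc →
  (if ⌊ ≡-dec _≟ℕ_ (stripZeros e) (stripZeros m) ⌋ then c else 0ℤ) +ℤ acc }) 0ℤ p

infix 4 _≈_
_≈_ : Poly → Poly → Set
P ≈ Q = ∀ m → coeff P m ≡ coeff Q m

ct : Poly → ℤ
ct P = coeff P []

onePoly : Poly
onePoly = (1ℤ , []) ∷ []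

negP : Poly → Poly
negP = map (λ { (c , e) → (- c , e) })

_-P_ : Poly → Poly → Poly
f -P g = f ++ negP g

-- Substitution at 0-based position k: x_{k+1} ↦ 0 and x_j ↦ x_{j-1} for
-- j > k+1.  On a monomial: vanishes if the exponent at k is nonzero,
-- otherwise position k is deleted.
removeAt : ℕ → Mono → Maybe Mono
removeAt zero    []          = just []
removeAt zero    (zero ∷ es) = just es
removeAt zero    (suc _ ∷ es) = nothing
removeAt (suc k) []          = just []
removeAt (suc k) (e ∷ es)    = mapᴹ (e ∷_) (removeAt k es)

mulVar : ℕ → Mono → Mono
mulVar zero    []       = 1 ∷ []
mulVar zero    (a ∷ es) = suc a ∷ es
mulVar (suc k) []       = 0 ∷ mulVar k []
mulVar (suc k) (a ∷ es) = a ∷ mulVar k es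

divVar : ℕ → Mono → Maybe Mono
divVar zero    []           = nothing
divVar zero    (zero ∷ es)  = nothing
divVar zero    (suc a ∷ es) = just (a ∷ es)
divVar (suc k) []           = nothing
divVar (suc k) (a ∷ es)     = mapᴹ (a ∷_) (divVar k es)

-- Operators, indexed 1-based by i ≥ 1 (as in the paper).

-- R_i f = f(x₁,…,x_{i-1},0,x_i,x_{i+1},…)
R : ℕ → Poly → Poly
R i = mapMaybe (λ { (c , e) → mapᴹ (c ,_) (removeAt (i ∸ 1) e) })

mulX : ℕ → Poly → Poly
mulX i = map (λ { (c , e) → (c , mulVar (i ∸ 1) e) })

-- exact division by x_i: terms not divisible by x_i are dropped (for a
-- polynomial divisible by x_i their total is 0).
divX : ℕ → Poly → Poly
divX i = mapMaybe (λ { (c , e) → mapᴹ (c ,_) (divVar (i ∸ 1) e) })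

-- T_i f = (R_{i+1} f - R_i f) / x_i   (always an exact division)
Top : ℕ → Poly → Poly
Top i f = divX i (R (suc i) f -P R i f)

π̃ : ℕ → Poly → Poly
π̃ i f = Top i (f ++ mulX (suc i) f)

-- full binary trees; leaf = trivial tree (single node)
data Tree : Set where
  leaf : Tree
  node : Tree → Tree → Tree

leaves : Tree → ℕ
leaves leaf       = 1
leaves (node l r) = leaves l + leaves r

-- An indexed forest (T₁, T₂, …) is represented by the finite list of its
-- trees up to the last nontrivial one; all later trees are leaves.
-- canonB: the list does not end with a trivial tree (canonical form).
canonB : List Tree → Bool
canonB []                  = true
canonB (leaf ∷ [])         = false
canonB (node _ _ ∷ [])     = true
canonB (_ ∷ t ∷ ts)        = canonB (t ∷ ts)

record Forest : Set where
  constructor forest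
  field
    trees : List Tree
    canon : T (canonB trees)
open Forest public

∅F : Forest
∅F = forest [] tt

consT : Tree → List Tree → List Tree
consT leaf []           = []
consT leaf (t ∷ l)      = leaf ∷ t ∷ l
consT (node a b) l      = node a b ∷ l

normF : List Tree → List Tree
normF = foldr consT []

consT-canon : ∀ t l → T (canonB l) → T (canonB (consT t l))
consT-canon leaf       []      _ = tt
consT-canon leaf       (u ∷ l) p = p
consT-canon (node a b) []      _ = tt
consT-canon (node a b) (u ∷ l) p = p

normF-canon : ∀ l → T (canonB (normF l))
normF-canon []      = tt
normF-canon (t ∷ l) = consT-canon t (normF l) (normF-canon l)

-- cherryT o i t : with o leaves before t, leaves i and i+1 are the left
-- and right children of a common internal node of t.
cherryT : ℕ → ℕ → Tree → Bool
cherryT o i leaf                = false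
cherryT o i (node leaf leaf)    = i ≡ᵇ suc o
cherryT o i (node leaf (node a b)) =
  cherryT o i leaf ∨ cherryT (o + 1) i (node a b)
cherryT o i (node (node a b) r) =
  cherryT o i (node a b) ∨ cherryT (o + leaves (node a b)) i r

cherryL : ℕ → ℕ → List Tree → Bool
cherryL o i []       = false
cherryL o i (t ∷ ts) = cherryT o i t ∨ cherryL (o + leaves t) i ts

-- i ∈ QDes(F)  (trailing trivial trees contain no internal node)
QDes : Forest → ℕ → Set
QDes F i = T (cherryL 0 i (trees F))

-- delete leaves i, i+1 if they form a cherry (the node becomes a leaf)
contractT : ℕ → ℕ → Tree → Tree
contractT o i leaf             = leaf
contractT o i (node leaf leaf) = if i ≡ᵇ suc o then leaf else node leaf leaf
contractT o i (node leaf (node a b)) =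
  node (contractT o i leaf) (contractT (o + 1) i (node a b))
contractT o i (node (node a b) r) =
  node (contractT o i (node a b)) (contractT (o + leaves (node a b)) i r)

contractL : ℕ → ℕ → List Tree → List Tree
contractL o i []       = []
contractL o i (t ∷ ts) = contractT o i t ∷ contractL (o + leaves t) i ts

-- F / i  (meaningful for i ∈ QDes(F)); leaves are relabeled implicitly.
_/F_ : Forest → ℕ → Forest
F /F i = forest (normF (contractL 0 i (trees F))) (normF-canon (contractL 0 i (trees F)))

IsFamily : (Forest → Poly) → Set
IsFamily P =
  (P ∅F ≈ onePoly)
  × (∀ F → ¬ (F ≡ ∅F) → ct (P F) ≡ 0ℤ)
  × (∀ F i → 1 ≤ i →
       (QDes F i → π̃ i (P F) ≈ P (F /F i))
       × (¬ (QDes F i) → π̃ i (P F) ≈ negP (R i (P F))))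

{-# OPTIONS --safe #-}
module Submission where

-- Let Δ_F be the coefficientwise difference P_F − Q_F of two such families; by
-- induction on d, Δ_F vanishes in degree d, degree 0 being the constant-term
-- condition.  Let ins k n be the exponent list n with a 0 inserted at (0-based)
-- position k.  For m of degree d,
--   [m] π̃_{k+1} f = [ins (k+1) (x_{k+1} m)] f − [ins k (x_{k+1} m)] f − [ins k m] f,
-- and both recurrences determine the left side for P_F and Q_F from coefficients
-- of degree d.  Hence Δ_F is unchanged when an exponent moves one place to the
-- right into a zero slot, so in degree d + 1, Δ_F(n) = Δ_F(0, n) = Δ_F(0, …, 0, n),
-- which is 0 once the leading zeros outnumber the variables of P_F and Q_F.

open import Defs
open import Data.Nat using (ℕ; zero; suc; _+_; _<_; _≤_; z≤n; s≤s; z<s)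
open import Data.Nat.Properties
  using (_≟_; +-suc; suc-injective; 1+n≢0; m+n≡0⇒m≡0; m+n≡0⇒n≡0; m≤m+n; m≤n+m; ≤-trans; <⇒≢; <⇒≱)
open import Data.Nat.ListAction using (sum)
open import Data.Bool using (if_then_else_)
open import Data.List using ([]; _∷_; _++_; length; replicate)
open import Data.List.Properties using (≡-dec; map-++; mapMaybe-++)
open import Data.Maybe using (just; nothing)
open import Data.Product using (_×_; _,_; proj₁; proj₂; ∃)
open import Data.Product.Function.NonDependent.Propositional using (_×-⇔_)
open import Data.Sum using (_⊎_; inj₁; inj₂)
open import Data.Integer using (ℤ; 0ℤ; -_; _-_) renaming (_+_ to _+ℤ_)
open import Data.Integer.Properties using (+-identityˡ; +-identityʳ; neg-distrib-+; +-assoc; +-inverseʳ; i-j≡0⇒i≡j)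
open import Data.Integer.Solver using (module +-*-Solver)
open import Data.Empty using (⊥-elim)
open import Function using (id)
open import Function.Bundles using (_⇔_; mk⇔; Equivalence)
open import Function.Properties.Equivalence using () renaming (refl to ⇔-refl; sym to ⇔-sym; trans to ⇔-trans)
open import Relation.Nullary using (¬_; yes; no)
open import Relation.Nullary.Decidable using (⌊_⌋; T?)
open import Relation.Binary.PropositionalEquality using (_≡_; refl; sym; trans; cong; cong₂; subst; module ≡-Reasoning)

open Equivalence using (to; from)

hd : Mono → ℕ
hd []      = 0
hd (a ∷ _) = a

tl : Mono → Mono
tl []      = []
tl (_ ∷ x) = x

at : ℕ → Mono → ℕ
at zero    x = hd x
at (suc j) x = at j (tl x)

ins : ℕ → Mono → Mono
ins zero    x = 0 ∷ x
ins (suc k) x = hd x ∷ ins k (tl x)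

infix 4 _~_
record _~_ (x y : Mono) : Set where
  constructor strip≡
  field stripped : stripZeros x ≡ stripZeros y
open _~_

~-refl : ∀ {x} → x ~ x
~-refl = strip≡ refl

~-sym : ∀ {x y} → x ~ y → y ~ x
~-sym (strip≡ p) = strip≡ (sym p)

~-trans : ∀ {x y z} → x ~ y → y ~ z → x ~ z
~-trans (strip≡ p) (strip≡ q) = strip≡ (trans p q)

stripZeros-hd-tl : ∀ x → stripZeros x ≡ consZ (hd x) (stripZeros (tl x))
stripZeros-hd-tl []      = refl
stripZeros-hd-tl (_ ∷ _) = refl

consZ-injective : ∀ a b s t → consZ a s ≡ consZ b t → a ≡ b × s ≡ t
consZ-injective zero    zero    []      []      refl = refl , refl
consZ-injective zero    zero    (_ ∷ _) (_ ∷ _) refl = refl , refl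
consZ-injective (suc a) (suc b) s       t       refl = refl , refl
consZ-injective zero    zero    []      (_ ∷ _) ()
consZ-injective zero    zero    (_ ∷ _) []      ()
consZ-injective zero    (suc b) []      t       ()
consZ-injective zero    (suc b) (_ ∷ _) t       ()
consZ-injective (suc a) zero    s       []      ()
consZ-injective (suc a) zero    s       (_ ∷ _) ()

~-cons : ∀ {x y} → x ~ y ⇔ (hd x ≡ hd y × tl x ~ tl y)
~-cons {x} {y} = mk⇔
  (λ (strip≡ p) → let h , t = consZ-injective _ _ _ _ (trans (sym (stripZeros-hd-tl x)) (trans p (stripZeros-hd-tl y)))
                   in h , strip≡ t)
  (λ (h , strip≡ t) → strip≡ (trans (stripZeros-hd-tl x) (trans (cong₂ consZ h t) (sym (stripZeros-hd-tl y)))))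

at-resp : ∀ j {x y} → x ~ y → at j x ≡ at j y
at-resp zero    x~y = proj₁ (to ~-cons x~y)
at-resp (suc j) x~y = at-resp j (proj₂ (to ~-cons x~y))

ins-~⇔ : ∀ k {x y} → ins k x ~ ins k y ⇔ x ~ y
ins-~⇔ zero    = ⇔-trans ~-cons (mk⇔ proj₂ (refl ,_))
ins-~⇔ (suc k) = ⇔-trans ~-cons (⇔-trans (⇔-refl ×-⇔ ins-~⇔ k) (⇔-sym ~-cons))

mulVar-zero : ∀ x → mulVar 0 x ≡ suc (hd x) ∷ tl x
mulVar-zero []      = refl
mulVar-zero (_ ∷ _) = refl

mulVar-suc : ∀ k x → mulVar (suc k) x ≡ hd x ∷ mulVar k (tl x)
mulVar-suc k []      = refl
mulVar-suc k (_ ∷ _) = refl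

mulVar-~⇔ : ∀ k {x y} → mulVar k x ~ mulVar k y ⇔ x ~ y
mulVar-~⇔ zero {x} {y} rewrite mulVar-zero x | mulVar-zero y =
  ⇔-trans ~-cons (⇔-trans (mk⇔ suc-injective (cong suc) ×-⇔ ⇔-refl) (⇔-sym ~-cons))
mulVar-~⇔ (suc k) {x} {y} rewrite mulVar-suc k x | mulVar-suc k y =
  ⇔-trans ~-cons (⇔-trans (⇔-refl ×-⇔ mulVar-~⇔ k) (⇔-sym ~-cons))

at-[] : ∀ k → at k [] ≡ 0
at-[] zero    = refl
at-[] (suc k) = at-[] k

at-ins : ∀ k x → at k (ins k x) ≡ 0
at-ins zero    x = refl
at-ins (suc k) x = at-ins k (tl x)

at-mulVar : ∀ k x → at k (mulVar k x) ≡ suc (at k x)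
at-mulVar zero    []      = refl
at-mulVar zero    (_ ∷ _) = refl
at-mulVar (suc k) []      = at-mulVar k []
at-mulVar (suc k) (_ ∷ x) = at-mulVar k x

ins-mulVar : ∀ k x → ins k (mulVar k x) ≡ mulVar (suc k) (ins k x)
ins-mulVar zero    x       = refl
ins-mulVar (suc k) []      = cong (0 ∷_) (ins-mulVar k [])
ins-mulVar (suc k) (a ∷ x) = cong (a ∷_) (ins-mulVar k x)

ins-length : ∀ x → ins (length x) x ~ x
ins-length []      = strip≡ refl
ins-length (_ ∷ x) = from ~-cons (refl , ins-length x)

at≡0⇒ins~ins-suc : ∀ j x → at j x ≡ 0 → ins j x ~ ins (suc j) x
at≡0⇒ins~ins-suc zero    x hd≡0 = from ~-cons (sym hd≡0 , from ~-cons (hd≡0 , ~-refl))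
at≡0⇒ins~ins-suc (suc j) x at≡0 = from ~-cons (refl , at≡0⇒ins~ins-suc j (tl x) at≡0)

[]~ins : ∀ k → [] ~ ins k []
[]~ins zero    = strip≡ refl
[]~ins (suc k) = from ~-cons (refl , []~ins k)

removeAt-just : ∀ k e {e′} → removeAt k e ≡ just e′ → e ~ ins k e′
removeAt-just zero    []           refl = strip≡ refl
removeAt-just zero    (zero ∷ _)   refl = ~-refl
removeAt-just zero    (suc _ ∷ _)  ()
removeAt-just (suc k) []           refl = []~ins (suc k)
removeAt-just (suc k) (a ∷ e) eq with removeAt k e in eq′
removeAt-just (suc k) (a ∷ e) refl | just _ = from ~-cons (refl , removeAt-just k e eq′)

removeAt-nothing : ∀ k e → removeAt k e ≡ nothing → ¬ at k e ≡ 0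
removeAt-nothing zero    (suc _ ∷ _) refl ()
removeAt-nothing (suc k) (a ∷ e) eq with removeAt k e in eq′
... | nothing = removeAt-nothing k e eq′

divVar-just : ∀ k e {e′} → divVar k e ≡ just e′ → e ≡ mulVar k e′
divVar-just zero    (suc _ ∷ _) refl = refl
divVar-just (suc k) (a ∷ e) eq with divVar k e in eq′
divVar-just (suc k) (a ∷ e) refl | just _ = cong (a ∷_) (divVar-just k e eq′)

divVar-nothing : ∀ k e → divVar k e ≡ nothing → at k e ≡ 0
divVar-nothing zero    []         refl = refl
divVar-nothing zero    (zero ∷ _) refl = refl
divVar-nothing (suc k) []         refl = at-[] k
divVar-nothing (suc k) (a ∷ e) eq with divVar k e in eq′
... | nothing = divVar-nothing k e eq′

mulVar-view : ∀ j n → at j n ≡ 0 ⊎ ∃ λ m → n ≡ mulVar j m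
mulVar-view j n with divVar j n in eq
... | nothing = inj₁ (divVar-nothing j n eq)
... | just m  = inj₂ (m , divVar-just j n eq)

sum-consZ : ∀ a s → sum (consZ a s) ≡ a + sum s
sum-consZ zero    []      = refl
sum-consZ zero    (_ ∷ _) = refl
sum-consZ (suc _) _       = refl

sum-stripZeros : ∀ x → sum (stripZeros x) ≡ sum x
sum-stripZeros []      = refl
sum-stripZeros (a ∷ x) = trans (sum-consZ a (stripZeros x)) (cong (a +_) (sum-stripZeros x))

sum-resp : ∀ {x y} → x ~ y → sum x ≡ sum y
sum-resp {x} {y} (strip≡ p) = trans (sym (sum-stripZeros x)) (trans (cong sum p) (sum-stripZeros y))

sum≡0⇒~[] : ∀ x → sum x ≡ 0 → x ~ []
sum≡0⇒~[] []      _      = ~-refl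
sum≡0⇒~[] (a ∷ x) sum≡0 = from ~-cons (m+n≡0⇒m≡0 a sum≡0 , sum≡0⇒~[] x (m+n≡0⇒n≡0 a sum≡0))

sum-hd-tl : ∀ x → hd x + sum (tl x) ≡ sum x
sum-hd-tl []      = refl
sum-hd-tl (_ ∷ _) = refl

sum-ins : ∀ k x → sum (ins k x) ≡ sum x
sum-ins zero    x = refl
sum-ins (suc k) x = trans (cong (hd x +_) (sum-ins k (tl x))) (sum-hd-tl x)

sum-mulVar : ∀ k x → sum (mulVar k x) ≡ suc (sum x)
sum-mulVar zero    []      = refl
sum-mulVar zero    (_ ∷ _) = refl
sum-mulVar (suc k) []      = sum-mulVar k []
sum-mulVar (suc k) (a ∷ x) = trans (cong (a +_) (sum-mulVar k x)) (+-suc a (sum x))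

sum-zeros++ : ∀ N x → sum (replicate N 0 ++ x) ≡ sum x
sum-zeros++ zero    x = refl
sum-zeros++ (suc N) x = sum-zeros++ N x

~-zeros++⇒<length : ∀ N e n → 0 < sum n → e ~ replicate N 0 ++ n → N < length e
~-zeros++⇒<length N       []      n 0<sum e~ = ⊥-elim (<⇒≢ 0<sum (trans (sum-resp e~) (sum-zeros++ N n)))
~-zeros++⇒<length zero    (_ ∷ _) n 0<sum e~ = s≤s z≤n
~-zeros++⇒<length (suc N) (_ ∷ e) n 0<sum e~ = s≤s (~-zeros++⇒<length N e n 0<sum (proj₂ (to ~-cons e~)))

termCoeff : ℤ → Mono → Mono → ℤ
termCoeff c e m = if ⌊ ≡-dec _≟_ (stripZeros e) (stripZeros m) ⌋ then c else 0ℤ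

termCoeff-≁ : ∀ c {e m} → ¬ e ~ m → termCoeff c e m ≡ 0ℤ
termCoeff-≁ c {e} {m} e≁m with ≡-dec _≟_ (stripZeros e) (stripZeros m)
... | yes p = ⊥-elim (e≁m (strip≡ p))
... | no  _ = refl

termCoeff-resp : ∀ c {e m e′ m′} → e ~ m ⇔ e′ ~ m′ → termCoeff c e m ≡ termCoeff c e′ m′
termCoeff-resp c {e} {m} {e′} {m′} iff
  with ≡-dec _≟_ (stripZeros e) (stripZeros m) | ≡-dec _≟_ (stripZeros e′) (stripZeros m′)
... | yes _ | yes _ = refl
... | no  _ | no  _ = refl
... | yes p | no ¬q = ⊥-elim (¬q (stripped (to iff (strip≡ p))))
... | no ¬p | yes q = ⊥-elim (¬p (stripped (from iff (strip≡ q))))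

termCoeff-neg : ∀ c e m → termCoeff (- c) e m ≡ - termCoeff c e m
termCoeff-neg c e m with ≡-dec _≟_ (stripZeros e) (stripZeros m)
... | yes _ = refl
... | no  _ = refl

coeff-++ : ∀ p q m → coeff (p ++ q) m ≡ coeff p m +ℤ coeff q m
coeff-++ []            q m = sym (+-identityˡ (coeff q m))
coeff-++ ((c , e) ∷ p) q m =
  trans (cong (termCoeff c e m +ℤ_) (coeff-++ p q m)) (sym (+-assoc (termCoeff c e m) _ _))

coeff-negP : ∀ p m → coeff (negP p) m ≡ - coeff p m
coeff-negP []            m = refl
coeff-negP ((c , e) ∷ p) m =
  trans (cong₂ _+ℤ_ (termCoeff-neg c e m) (coeff-negP p m)) (sym (neg-distrib-+ (termCoeff c e m) _))

coeff-[-P] : ∀ p q m → coeff (p -P q) m ≡ coeff p m - coeff q m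
coeff-[-P] p q m = trans (coeff-++ p (negP q) m) (cong (coeff p m +ℤ_) (coeff-negP q m))

coeff-termwise : (L : Poly → Poly) → L [] ≡ [] → (∀ p q → L (p ++ q) ≡ L p ++ L q) →
                 ∀ {m m′} → (∀ t → coeff (L (t ∷ [])) m ≡ coeff (t ∷ []) m′) →
                 ∀ p → coeff (L p) m ≡ coeff p m′
coeff-termwise L L[] L-++ {m} {m′} L-term [] = cong (λ q → coeff q m) L[]
coeff-termwise L L[] L-++ {m} {m′} L-term (t ∷ p) = begin
  coeff (L (t ∷ p)) m                       ≡⟨ cong (λ q → coeff q m) (L-++ (t ∷ []) p) ⟩
  coeff (L (t ∷ []) ++ L p) m               ≡⟨ coeff-++ (L (t ∷ [])) (L p) m ⟩
  coeff (L (t ∷ [])) m +ℤ coeff (L p) m     ≡⟨ cong₂ _+ℤ_ (L-term t) (coeff-termwise L L[] L-++ {m} {m′} L-term p) ⟩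
  coeff (t ∷ []) m′ +ℤ coeff p m′           ≡⟨ coeff-++ (t ∷ []) p m′ ⟨
  coeff (t ∷ p) m′                          ∎
  where open ≡-Reasoning

coeff-resp : ∀ p {x y} → x ~ y → coeff p x ≡ coeff p y
coeff-resp p {x} {y} x~y = coeff-termwise id refl (λ _ _ → refl) {x} {y} term p
  where
  term : ∀ t → coeff (t ∷ []) x ≡ coeff (t ∷ []) y
  term (c , e) = cong (_+ℤ 0ℤ) (termCoeff-resp c {e} {x} {e} {y} (mk⇔ (λ e~x → ~-trans e~x x~y) (λ e~y → ~-trans e~y (~-sym x~y))))

coeff-R-term : ∀ k t m → coeff (R (suc k) (t ∷ [])) m ≡ coeff (t ∷ []) (ins k m)
coeff-R-term k (c , e) m with removeAt k e in eq
... | just e′ = cong (_+ℤ 0ℤ) (termCoeff-resp c (⇔-sym (⇔-trans e~ins⇔ (ins-~⇔ k))))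
  where
  e~ins⇔ : e ~ ins k m ⇔ ins k e′ ~ ins k m
  e~ins⇔ = let e~ = removeAt-just k e eq in mk⇔ (~-trans (~-sym e~)) (~-trans e~)
... | nothing = sym (cong (_+ℤ 0ℤ) (termCoeff-≁ c (λ e~ → removeAt-nothing k e eq (trans (at-resp k e~) (at-ins k m)))))

coeff-R : ∀ k p m → coeff (R (suc k) p) m ≡ coeff p (ins k m)
coeff-R k p m = coeff-termwise (R (suc k)) refl (mapMaybe-++ _) {m} {ins k m} (λ t → coeff-R-term k t m) p

coeff-divX-term : ∀ k t m → coeff (divX (suc k) (t ∷ [])) m ≡ coeff (t ∷ []) (mulVar k m)
coeff-divX-term k (c , e) m with divVar k e in eq
... | just e′ rewrite divVar-just k e eq = cong (_+ℤ 0ℤ) (termCoeff-resp c (⇔-sym (mulVar-~⇔ k)))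
... | nothing = sym (cong (_+ℤ 0ℤ) (termCoeff-≁ c (λ e~ →
  1+n≢0 (trans (sym (at-mulVar k m)) (trans (sym (at-resp k e~)) (divVar-nothing k e eq))))))

coeff-divX : ∀ k p m → coeff (divX (suc k) p) m ≡ coeff p (mulVar k m)
coeff-divX k p m = coeff-termwise (divX (suc k)) refl (mapMaybe-++ _) {m} {mulVar k m} (λ t → coeff-divX-term k t m) p

coeff-mulX-mulVar : ∀ k p m → coeff (mulX (suc k) p) (mulVar k m) ≡ coeff p m
coeff-mulX-mulVar k p m = coeff-termwise (mulX (suc k)) refl (map-++ _) {mulVar k m} {m} term p
  where
  term : ∀ t → coeff (mulX (suc k) (t ∷ [])) (mulVar k m) ≡ coeff (t ∷ []) m
  term (c , e) = cong (_+ℤ 0ℤ) (termCoeff-resp c (mulVar-~⇔ k))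

coeff-mulX-at≡0 : ∀ k {n} → at k n ≡ 0 → ∀ p → coeff (mulX (suc k) p) n ≡ 0ℤ
coeff-mulX-at≡0 k at≡0 []            = refl
coeff-mulX-at≡0 k at≡0 ((c , e) ∷ p) = cong₂ _+ℤ_
  (termCoeff-≁ c (λ e~ → 1+n≢0 (trans (sym (at-mulVar k e)) (trans (at-resp k e~) at≡0))))
  (coeff-mulX-at≡0 k at≡0 p)

coeff-π̃ : ∀ k f m → coeff (π̃ (suc k) f) m ≡
  coeff f (ins (suc k) (mulVar k m)) - (coeff f (ins k (mulVar k m)) +ℤ coeff f (ins k m))
coeff-π̃ k f m = begin
  coeff (π̃ (suc k) f) m
    ≡⟨ coeff-divX k (R (suc (suc k)) g -P R (suc k) g) m ⟩
  coeff (R (suc (suc k)) g -P R (suc k) g) x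
    ≡⟨ coeff-[-P] (R (suc (suc k)) g) (R (suc k) g) x ⟩
  coeff (R (suc (suc k)) g) x - coeff (R (suc k) g) x
    ≡⟨ cong₂ _-_ (coeff-R (suc k) g x) (coeff-R k g x) ⟩
  coeff g (ins (suc k) x) - coeff g (ins k x)
    ≡⟨ cong₂ _-_ (coeff-++ f fx (ins (suc k) x)) (coeff-++ f fx (ins k x)) ⟩
  (coeff f (ins (suc k) x) +ℤ coeff fx (ins (suc k) x)) - (coeff f (ins k x) +ℤ coeff fx (ins k x))
    ≡⟨ cong₂ (λ u v → (coeff f (ins (suc k) x) +ℤ u) - (coeff f (ins k x) +ℤ v))
         (coeff-mulX-at≡0 (suc k) (at-ins (suc k) x) f)
         (trans (cong (coeff fx) (ins-mulVar k m)) (coeff-mulX-mulVar (suc k) f (ins k m))) ⟩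
  (coeff f (ins (suc k) x) +ℤ 0ℤ) - (coeff f (ins k x) +ℤ coeff f (ins k m))
    ≡⟨ cong (_- (coeff f (ins k x) +ℤ coeff f (ins k m))) (+-identityʳ (coeff f (ins (suc k) x))) ⟩
  coeff f (ins (suc k) x) - (coeff f (ins k x) +ℤ coeff f (ins k m))
    ∎
  where
  open ≡-Reasoning
  x  = mulVar k m
  fx = mulX (suc (suc k)) f
  g  = f ++ fx

width : Poly → ℕ
width []            = 0
width ((_ , e) ∷ p) = length e + width p

coeff-zeros++ : ∀ p N n → width p ≤ N → 0 < sum n → coeff p (replicate N 0 ++ n) ≡ 0ℤ
coeff-zeros++ []            N n _ _     = refl
coeff-zeros++ ((c , e) ∷ p) N n w≤N 0<sum = cong₂ _+ℤ_
  (termCoeff-≁ c (λ e~ → <⇒≱ (~-zeros++⇒<length N e n 0<sum e~) (≤-trans (m≤m+n (length e) (width p)) w≤N)))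
  (coeff-zeros++ p N n (≤-trans (m≤n+m (width p) (length e)) w≤N) 0<sum)

a-[b+c]≡a′-[b′+c]⇒a-a′≡b-b′ : ∀ a b c a′ b′ → a - (b +ℤ c) ≡ a′ - (b′ +ℤ c) → a - a′ ≡ b - b′
a-[b+c]≡a′-[b′+c]⇒a-a′≡b-b′ a b c a′ b′ eq = i-j≡0⇒i≡j (a - a′) (b - b′) (begin
  (a - a′) - (b - b′)                   ≡⟨ regroup a b c a′ b′ ⟩
  (a - (b +ℤ c)) - (a′ - (b′ +ℤ c))     ≡⟨ cong (_- (a′ - (b′ +ℤ c))) eq ⟩
  (a′ - (b′ +ℤ c)) - (a′ - (b′ +ℤ c))   ≡⟨ +-inverseʳ (a′ - (b′ +ℤ c)) ⟩
  0ℤ                                     ∎)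
  where
  open ≡-Reasoning
  open +-*-Solver
  regroup : ∀ a b c a′ b′ → (a - a′) - (b - b′) ≡ (a - (b +ℤ c)) - (a′ - (b′ +ℤ c))
  regroup = solve 5 (λ a b c a′ b′ → (a :- a′) :- (b :- b′) := (a :- (b :+ c)) :- (a′ :- (b′ :+ c))) refl

module _ (P : Forest → Poly) (hP : IsFamily P) where

  coeff-π̃-QDes : ∀ F k → QDes F (suc k) → ∀ m → coeff (π̃ (suc k) (P F)) m ≡ coeff (P (F /F suc k)) m
  coeff-π̃-QDes F k i∈QDes = proj₁ (proj₂ (proj₂ hP) F (suc k) (s≤s z≤n)) i∈QDes

  coeff-π̃-¬QDes : ∀ F k → ¬ QDes F (suc k) → ∀ m → coeff (π̃ (suc k) (P F)) m ≡ - coeff (P F) (ins k m)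
  coeff-π̃-¬QDes F k i∉QDes m = begin
    coeff (π̃ (suc k) (P F)) m        ≡⟨ proj₂ (proj₂ (proj₂ hP) F (suc k) (s≤s z≤n)) i∉QDes m ⟩
    coeff (negP (R (suc k) (P F))) m  ≡⟨ coeff-negP (R (suc k) (P F)) m ⟩
    - coeff (R (suc k) (P F)) m       ≡⟨ cong -_ (coeff-R k (P F) m) ⟩
    - coeff (P F) (ins k m)           ∎
    where open ≡-Reasoning


module _ (P Q : Forest → Poly) (hP : IsFamily P) (hQ : IsFamily Q) where

  AgreeInDegree : ℕ → Set
  AgreeInDegree d = ∀ F m → sum m ≡ d → coeff (P F) m ≡ coeff (Q F) m

  Δ : Forest → Mono → ℤ
  Δ F m = coeff (P F) m - coeff (Q F) m

  Δ-resp : ∀ F {x y} → x ~ y → Δ F x ≡ Δ F y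
  Δ-resp F x~y = cong₂ _-_ (coeff-resp (P F) x~y) (coeff-resp (Q F) x~y)

  ct-agree : ∀ F → ct (P F) ≡ ct (Q F)
  ct-agree (forest [] _)        = trans (proj₁ hP []) (sym (proj₁ hQ []))
  ct-agree F@(forest (_ ∷ _) _) = trans (proj₁ (proj₂ hP) F λ ()) (sym (proj₁ (proj₂ hQ) F λ ()))

  agree-0 : AgreeInDegree 0
  agree-0 F m sum≡0 = begin
    coeff (P F) m   ≡⟨ coeff-resp (P F) m~[] ⟩
    ct (P F)        ≡⟨ ct-agree F ⟩
    ct (Q F)        ≡⟨ coeff-resp (Q F) m~[] ⟨
    coeff (Q F) m   ∎
    where
    open ≡-Reasoning
    m~[] = sum≡0⇒~[] m sum≡0

  module _ {d} (agree-d : AgreeInDegree d) where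

    coeff-π̃-agree : ∀ F k m → sum m ≡ d → coeff (π̃ (suc k) (P F)) m ≡ coeff (π̃ (suc k) (Q F)) m
    coeff-π̃-agree F k m sum≡d with T? (cherryL 0 (suc k) (trees F))
    ... | yes i∈QDes = begin
      coeff (π̃ (suc k) (P F)) m   ≡⟨ coeff-π̃-QDes P hP F k i∈QDes m ⟩
      coeff (P (F /F suc k)) m    ≡⟨ agree-d (F /F suc k) m sum≡d ⟩
      coeff (Q (F /F suc k)) m    ≡⟨ coeff-π̃-QDes Q hQ F k i∈QDes m ⟨
      coeff (π̃ (suc k) (Q F)) m   ∎
      where open ≡-Reasoning
    ... | no i∉QDes = begin
      coeff (π̃ (suc k) (P F)) m   ≡⟨ coeff-π̃-¬QDes P hP F k i∉QDes m ⟩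
      - coeff (P F) (ins k m)     ≡⟨ cong -_ (agree-d F (ins k m) (trans (sum-ins k m) sum≡d)) ⟩
      - coeff (Q F) (ins k m)     ≡⟨ coeff-π̃-¬QDes Q hQ F k i∉QDes m ⟨
      coeff (π̃ (suc k) (Q F)) m   ∎
      where open ≡-Reasoning

    Δ-shift : ∀ F k m → sum m ≡ d → Δ F (ins (suc k) (mulVar k m)) ≡ Δ F (ins k (mulVar k m))
    Δ-shift F k m sum≡d = a-[b+c]≡a′-[b′+c]⇒a-a′≡b-b′
      (coeff (P F) (ins (suc k) x)) (coeff (P F) (ins k x)) (coeff (P F) (ins k m))
      (coeff (Q F) (ins (suc k) x)) (coeff (Q F) (ins k x)) (begin
      coeff (P F) (ins (suc k) x) - (coeff (P F) (ins k x) +ℤ coeff (P F) (ins k m))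
        ≡⟨ coeff-π̃ k (P F) m ⟨
      coeff (π̃ (suc k) (P F)) m
        ≡⟨ coeff-π̃-agree F k m sum≡d ⟩
      coeff (π̃ (suc k) (Q F)) m
        ≡⟨ coeff-π̃ k (Q F) m ⟩
      coeff (Q F) (ins (suc k) x) - (coeff (Q F) (ins k x) +ℤ coeff (Q F) (ins k m))
        ≡⟨ cong (λ c → coeff (Q F) (ins (suc k) x) - (coeff (Q F) (ins k x) +ℤ c))
             (agree-d F (ins k m) (trans (sum-ins k m) sum≡d)) ⟨
      coeff (Q F) (ins (suc k) x) - (coeff (Q F) (ins k x) +ℤ coeff (P F) (ins k m))
        ∎)
      where
      open ≡-Reasoning
      x = mulVar k m

    Δ-ins-suc : ∀ F j n → sum n ≡ suc d → Δ F (ins j n) ≡ Δ F (ins (suc j) n)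
    Δ-ins-suc F j n sum≡ with mulVar-view j n
    ... | inj₁ at≡0         = Δ-resp F (at≡0⇒ins~ins-suc j n at≡0)
    ... | inj₂ (m , refl) = sym (Δ-shift F j m (suc-injective (trans (sym (sum-mulVar j m)) sum≡)))

    Δ-ins : ∀ F j n → sum n ≡ suc d → Δ F (0 ∷ n) ≡ Δ F (ins j n)
    Δ-ins F zero    n sum≡ = refl
    Δ-ins F (suc j) n sum≡ = trans (Δ-ins F j n sum≡) (Δ-ins-suc F j n sum≡)

    Δ-zeros++ : ∀ F N n → sum n ≡ suc d → Δ F (replicate N 0 ++ n) ≡ Δ F n
    Δ-zeros++ F zero    n sum≡ = refl
    Δ-zeros++ F (suc N) n sum≡ = begin
      Δ F (0 ∷ n′)                ≡⟨ Δ-ins F (length n′) n′ (trans (sum-zeros++ N n) sum≡) ⟩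
      Δ F (ins (length n′) n′)    ≡⟨ Δ-resp F (ins-length n′) ⟩
      Δ F n′                      ≡⟨ Δ-zeros++ F N n sum≡ ⟩
      Δ F n                       ∎
      where
      open ≡-Reasoning
      n′ = replicate N 0 ++ n

    agree-suc : AgreeInDegree (suc d)
    agree-suc F n sum≡ = i-j≡0⇒i≡j _ _ (begin
      Δ F n                       ≡⟨ Δ-zeros++ F N n sum≡ ⟨
      Δ F (replicate N 0 ++ n)    ≡⟨ cong₂ _-_ (coeff-zeros++ (P F) N n (m≤m+n _ _) 0<sum)
                                               (coeff-zeros++ (Q F) N n (m≤n+m _ _) 0<sum) ⟩
      0ℤ - 0ℤ                     ≡⟨⟩
      0ℤ                          ∎)
      where
      open ≡-Reasoning
      N = width (P F) + width (Q F)
      0<sum = subst (0 <_) (sym sum≡) z<s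

  agree : ∀ d → AgreeInDegree d
  agree zero    = agree-0
  agree (suc d) = agree-suc (agree d)

lemma3p7 : (P Q : Forest → Poly) → IsFamily P → IsFamily Q → (F : Forest) → P F ≈ Q F
lemma3p7 P Q hP hQ F m = agree P Q hP hQ (sum m) F m refl
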